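{- Let $L$ be a finite lattice with exactly two coatoms and $U$ a finite lattice with exactly two atoms. Then every vertical 2-sum of $L$ and $U$ is a lattice.
   Context: Let $\top_L$ be the top of $L$ and $\bot_U$ the bottom of $U$, and let $L' = L\setminus\{\top_L\}$, $U'=U\setminus\{\bot_U\}$ with their induced orders. A vertical 2-sum of $L$ and $U$ is the poset obtained from the disjoint union of $L'$ and $U'$ by identifying the two coatoms of $L$ with the two atoms of $U$ via some bijection, the order being the transitive closure of the union of the orders of $L'$ and $U'$ (so for $x\in L'$, $y\in U'$ one has $x\le y$ iff $x\le c\le y$ for some identified element $c$). There may be two nonisomorphic vertical 2-sums, depending on the chosen bijection. -}

module Defs where

open import Data.Nat using (ℕ)
open import Data.Fin using (Fin)
open import Data.Product using (Σ; ∃; _×_; _,_)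
open import Data.Sum using (_⊎_; inj₁; inj₂)
open import Relation.Nullary using (¬_)
open import Relation.Binary.PropositionalEquality using (_≡_; _≢_)
open import Relation.Binary.Core using (Rel)
open import Relation.Binary.Lattice.Structures using (IsLattice)
open import Relation.Binary.Construct.Closure.ReflexiveTransitive using (Star)
open import Function.Bundles using (_↔_)

record FiniteLattice : Set₁ where
  field
    Carrier   : Set
    _≤_       : Rel Carrier _
    _∨_       : Carrier → Carrier → Carrier
    _∧_       : Carrier → Carrier → Carrier
    isLattice : IsLattice _≡_ _≤_ _∨_ _∧_
    size      : ℕ
    finite    : Carrier ↔ Fin size

module _ (P : FiniteLattice) where
  open FiniteLattice P

  IsTop : Carrier → Set
  IsTop t = ∀ x → x ≤ t

  IsBot : Carrier → Set
  IsBot b = ∀ x → b ≤ x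

  _⋖_ : Carrier → Carrier → Set
  a ⋖ b = (a ≤ b) × (a ≢ b) × (∀ x → a ≤ x → x ≤ b → (x ≡ a) ⊎ (x ≡ b))

  IsCoatom : Carrier → Set
  IsCoatom c = ∃ λ t → IsTop t × (c ⋖ t)

  IsAtom : Carrier → Set
  IsAtom a = ∃ λ b → IsBot b × (b ⋖ a)

  ExactlyTwo : (Carrier → Set) → Carrier → Carrier → Set
  ExactlyTwo Q x y = Q x × Q y × (x ≢ y) × (∀ z → Q z → (z ≡ x) ⊎ (z ≡ y))

-- L' = L \ {⊤L}, U' = U \ {⊥U}; the coatom c₁ (resp. c₂)
-- of L is identified with the atom a₁ (resp. a₂) of U.  Every bijection
-- between the two coatoms and the two atoms is of this form for a suitable
-- naming of the atoms.  The underlying set is the disjoint union L' ⊎ U'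
-- modulo the identifications; the order is the reflexive-transitive closure
-- of the union of the orders of L' and U' together with the identifications
-- (in both directions), so that identified elements become equivalent.

module VerticalTwoSum (L U : FiniteLattice)
  (⊤L : FiniteLattice.Carrier L) (⊥U : FiniteLattice.Carrier U)
  (c₁ c₂ : FiniteLattice.Carrier L) (a₁ a₂ : FiniteLattice.Carrier U) where

  private
    module L = FiniteLattice L
    module U = FiniteLattice U

  L' : Set
  L' = Σ L.Carrier (λ x → x ≢ ⊤L)

  U' : Set
  U' = Σ U.Carrier (λ y → y ≢ ⊥U)

  Elem : Set
  Elem = L' ⊎ U'

  Identified : L.Carrier → U.Carrier → Set
  Identified x y = ((x ≡ c₁) × (y ≡ a₁)) ⊎ ((x ≡ c₂) × (y ≡ a₂))

  data Step : Elem → Elem → Set where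
    inL   : ∀ {x x'} → L._≤_ (Σ.proj₁ x) (Σ.proj₁ x') → Step (inj₁ x) (inj₁ x')
    inU   : ∀ {y y'} → U._≤_ (Σ.proj₁ y) (Σ.proj₁ y') → Step (inj₂ y) (inj₂ y')
    glueLU : ∀ {x y} → Identified (Σ.proj₁ x) (Σ.proj₁ y) → Step (inj₁ x) (inj₂ y)
    glueUL : ∀ {x y} → Identified (Σ.proj₁ x) (Σ.proj₁ y) → Step (inj₂ y) (inj₁ x)

  -- the order of the vertical 2-sum (a preorder on representatives; the
  -- poset is its quotient by mutual ≤, i.e. by the identifications)
  _≤_ : Elem → Elem → Set
  _≤_ = Star Step

-- Lattice property of a preorder: every two elements have a least upper
-- bound and a greatest lower bound (equivalently, the quotient poset is a
-- lattice).

IsLatticeOrder : {A : Set} → (A → A → Set) → Set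
IsLatticeOrder {A} _≤_ =
  (∀ x y → ∃ λ j → (x ≤ j) × (y ≤ j) × (∀ z → x ≤ z → y ≤ z → j ≤ z)) ×
  (∀ x y → ∃ λ m → (m ≤ x) × (m ≤ y) × (∀ z → z ≤ x → z ≤ y → z ≤ m))

-- Write P for L (a finite lattice whose coatoms are exactly c₁, c₂) and Q for
-- the order-dual of U (whose coatoms are then exactly the atoms a₁, a₂ of U).
-- The vertical 2-sum is the union of P' = P \ {⊤} and Q' = Q \ {⊤}, where P'
-- carries the order of P, Q' the reverse order of Q, and x ∈ P' lies below
-- u ∈ Q' iff x ≤ cᵢ in P and u ≤ aᵢ in Q for some i (and dually for u below x).
module Submission where

open import Data.Bool using (Bool; true; false)
open import Data.Bool.Properties using () renaming (_≟_ to _≟ᵇ_)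
open import Data.Empty using (⊥-elim)
open import Data.Fin.Properties using (inj⇒≟)
open import Data.List using (List; []; _∷_; map; allFin)
open import Data.List.Membership.Propositional using (_∈_)
open import Data.List.Membership.Propositional.Properties using (∈-map⁺; ∈-allFin)
open import Data.List.Relation.Unary.Any using (here; there)
open import Data.Product using (∃; _×_; _,_; proj₁; proj₂)
open import Data.Sum using (_⊎_; inj₁; inj₂; [_,_]; swap)
open import Data.Sum.Properties using (swap-involutive)
open import Function using (flip)
open import Function.Bundles using (Inverse)
open import Function.Properties.Inverse using (↔⇒↣)
open import Level using (0ℓ)
open import Relation.Binary.Definitions using (DecidableEquality; Decidable)
open import Relation.Binary.Lattice.Bundles using (Lattice)
open import Relation.Binary.Lattice.Structures using (IsLattice)
import Relation.Binary.Lattice.Properties.JoinSemilattice as JoinProperties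
import Relation.Binary.Lattice.Properties.Lattice as LatticeProperties
open import Relation.Binary.Construct.Closure.ReflexiveTransitive using (ε; _◅_; fold)
open import Relation.Binary.PropositionalEquality using (_≡_; _≢_; refl; sym; trans; subst)
open import Relation.Nullary using (Dec; yes; no)
open import Relation.Nullary.Decidable using (map′; _×-dec_; _⊎-dec_)

open import Defs

IsJoin : {A : Set} → (A → A → Set) → A → A → A → Set
IsJoin _≤_ x y j = (x ≤ j) × (y ≤ j) × (∀ z → x ≤ z → y ≤ z → j ≤ z)

HasJoins : {A : Set} → (A → A → Set) → Set
HasJoins _≤_ = ∀ x y → ∃ (IsJoin _≤_ x y)

HasMeets : {A : Set} → (A → A → Set) → Set
HasMeets _≤_ = ∀ x y → ∃ λ m → (m ≤ x) × (m ≤ y) × (∀ z → z ≤ x → z ≤ y → z ≤ m)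

lattice-order-resp-⇔ : {A : Set} {R S : A → A → Set}
  → (∀ {x y} → R x y → S x y) → (∀ {x y} → S x y → R x y)
  → IsLatticeOrder R → IsLatticeOrder S
lattice-order-resp-⇔ R⇒S S⇒R (joins , meets) =
  (λ x y → let j , x≤j , y≤j , least = joins x y in
     j , R⇒S x≤j , R⇒S y≤j , λ z x≤z y≤z → R⇒S (least z (S⇒R x≤z) (S⇒R y≤z))) ,
  (λ x y → let m , m≤x , m≤y , greatest = meets x y in
     m , R⇒S m≤x , R⇒S m≤y , λ z z≤x z≤y → R⇒S (greatest z (S⇒R z≤x) (S⇒R z≤y)))

meets-from-opposite-joins : {A B : Set} {R : A → A → Set} {S : B → B → Set}
  (f : A → B) (g : B → A) → (∀ x → g (f x) ≡ x)
  → (∀ x y → R x y → S (f y) (f x)) → (∀ x y → S x y → R (g y) (g x))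
  → HasJoins S → HasMeets R
meets-from-opposite-joins {R = R} f g g∘f R⇒S S⇒R joins x y =
  let j , fx≤j , fy≤j , least = joins (f x) (f y) in
  g j ,
  subst (R (g j)) (g∘f x) (S⇒R _ _ fx≤j) ,
  subst (R (g j)) (g∘f y) (S⇒R _ _ fy≤j) ,
  λ z z≤x z≤y → subst (λ w → R w (g j)) (g∘f z)
                  (S⇒R _ _ (least (f z) (R⇒S _ _ z≤x) (R⇒S _ _ z≤y)))

module FiniteLatticeFacts (P : FiniteLattice) where
  open FiniteLattice P public
  open IsLattice isLattice public renaming (refl to ≤-refl; trans to ≤-trans)

  asLattice : Lattice 0ℓ 0ℓ 0ℓ
  asLattice = record { isLattice = isLattice }

  open JoinProperties (Lattice.joinSemilattice asLattice) public
    using (∨-monotonic; x≤y⇒x∨y≈y)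

  _≟_ : DecidableEquality Carrier
  _≟_ = inj⇒≟ (↔⇒↣ finite)

  _≤?_ : Decidable _≤_
  _≤?_ = JoinProperties.≈-dec⇒≤-dec (Lattice.joinSemilattice asLattice) _≟_

  elements : List Carrier
  elements = map (Inverse.from finite) (allFin size)

  ∈-elements : ∀ x → x ∈ elements
  ∈-elements x = subst (_∈ elements) (Inverse.strictlyInverseʳ finite x)
    (∈-map⁺ (Inverse.from finite) (∈-allFin (Inverse.to finite x)))

  private
    module Saturation {⊤ : Carrier} (⊤-top : IsTop P ⊤) where

      Saturated : Carrier → Carrier → Set
      Saturated z w = (z ∨ w ≡ ⊤) ⊎ (w ≤ z)

      saturated-mono : ∀ {z z' w} → z ≤ z' → Saturated z w → Saturated z' w
      saturated-mono {z} {z'} {w} z≤z' (inj₁ z∨w≡⊤) =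
        inj₁ (antisym (⊤-top _) (subst (_≤ (z' ∨ w)) z∨w≡⊤ (∨-monotonic z≤z' ≤-refl)))
      saturated-mono z≤z' (inj₂ w≤z) = inj₂ (≤-trans w≤z z≤z')

      saturate : ∀ z ws → z ≢ ⊤
        → ∃ λ z' → (z ≤ z') × (z' ≢ ⊤) × (∀ w → w ∈ ws → Saturated z' w)
      saturate z [] z≢⊤ = z , ≤-refl , z≢⊤ , λ _ ()
      saturate z (w ∷ ws) z≢⊤ with (z ∨ w) ≟ ⊤
      ... | yes z∨w≡⊤ =
        let z' , z≤z' , z'≢⊤ , sat = saturate z ws z≢⊤ in
        z' , z≤z' , z'≢⊤ , λ where
          _ (here refl) → saturated-mono z≤z' (inj₁ z∨w≡⊤)
          v (there v∈ws) → sat v v∈ws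
      ... | no z∨w≢⊤ =
        let z' , z∨w≤z' , z'≢⊤ , sat = saturate (z ∨ w) ws z∨w≢⊤ in
        z' , ≤-trans (x≤x∨y z w) z∨w≤z' , z'≢⊤ , λ where
          _ (here refl) → saturated-mono z∨w≤z' (inj₂ (y≤x∨y z w))
          v (there v∈ws) → sat v v∈ws

      saturated-maximal : ∀ {z v} → z ≤ v → Saturated z v → (v ≡ z) ⊎ (v ≡ ⊤)
      saturated-maximal z≤v (inj₁ z∨v≡⊤) = inj₂ (trans (sym (x≤y⇒x∨y≈y z≤v)) z∨v≡⊤)
      saturated-maximal z≤v (inj₂ v≤z) = inj₁ (antisym v≤z z≤v)

  -- In a finite lattice every non-top element lies below a coatom: saturate
  -- it with respect to a list of all elements.
  below-coatom : ∀ {⊤} → IsTop P ⊤ → ∀ x → x ≢ ⊤ → ∃ λ z → IsCoatom P z × (x ≤ z)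
  below-coatom {⊤} ⊤-top x x≢⊤ =
    let z , x≤z , z≢⊤ , sat = saturate x elements x≢⊤ in
    z , (⊤ , ⊤-top , ⊤-top z , z≢⊤ ,
         λ v z≤v _ → saturated-maximal z≤v (sat v (∈-elements v))) , x≤z
    where open Saturation ⊤-top

opposite : FiniteLattice → FiniteLattice
opposite P = record
  { Carrier   = Carrier
  ; _≤_       = flip _≤_
  ; _∨_       = _∧_
  ; _∧_       = _∨_
  ; isLattice = LatticeProperties.∧-∨-isLattice asLattice
  ; size      = size
  ; finite    = finite
  }
  where open FiniteLatticeFacts P

⋖-opposite : (P : FiniteLattice) {a b : FiniteLattice.Carrier P}
  → _⋖_ P a b → _⋖_ (opposite P) b a
⋖-opposite P (a≤b , a≢b , between) =
  a≤b , (λ b≡a → a≢b (sym b≡a)) , λ x x≤b a≤x → swap (between x a≤x x≤b)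

atoms-are-opposite-coatoms : (U : FiniteLattice) {a₁ a₂ : FiniteLattice.Carrier U}
  → ExactlyTwo U (IsAtom U) a₁ a₂ → ExactlyTwo (opposite U) (IsCoatom (opposite U)) a₁ a₂
atoms-are-opposite-coatoms U (atom₁ , atom₂ , a₁≢a₂ , only) =
  coatom atom₁ , coatom atom₂ , a₁≢a₂ ,
  λ z (b , b-bot , z⋖b) → only z (b , b-bot , ⋖-opposite (opposite U) z⋖b)
  where
  coatom : ∀ {a} → IsAtom U a → IsCoatom (opposite U) a
  coatom (b , b-bot , b⋖a) = b , b-bot , ⋖-opposite U b⋖a

record TwoCoatomLattice : Set₁ where
  field
    lattice : FiniteLattice
    ⊤       : FiniteLattice.Carrier lattice
    ⊤-top   : IsTop lattice ⊤
    c₁ c₂   : FiniteLattice.Carrier lattice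
    coatoms : ExactlyTwo lattice (IsCoatom lattice) c₁ c₂

module TwoCoatoms (T : TwoCoatomLattice) where
  open TwoCoatomLattice T public
  open FiniteLatticeFacts lattice public

  c : Bool → Carrier
  c true  = c₁
  c false = c₂

  private
    top-unique : ∀ {t} → IsTop lattice t → t ≡ ⊤
    top-unique t-top = antisym (⊤-top _) (t-top ⊤)

    c-coatom : ∀ i → IsCoatom lattice (c i)
    c-coatom true  = proj₁ coatoms
    c-coatom false = proj₁ (proj₂ coatoms)

    c₁≢c₂ : c₁ ≢ c₂
    c₁≢c₂ = proj₁ (proj₂ (proj₂ coatoms))

    coatom-is-c : ∀ z → IsCoatom lattice z → (z ≡ c₁) ⊎ (z ≡ c₂)
    coatom-is-c = proj₂ (proj₂ (proj₂ coatoms))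

  c≢⊤ : ∀ i → c i ≢ ⊤
  c≢⊤ i ci≡⊤ with c-coatom i
  ... | t , t-top , _ , ci≢t , _ = ci≢t (trans ci≡⊤ (sym (top-unique t-top)))

  c-cover : ∀ i {z} → c i ≤ z → z ≢ ⊤ → z ≡ c i
  c-cover i ci≤z z≢⊤ with c-coatom i
  ... | t , t-top , _ , _ , between with between _ ci≤z (t-top _)
  ...   | inj₁ z≡ci = z≡ci
  ...   | inj₂ z≡t = ⊥-elim (z≢⊤ (trans z≡t (top-unique t-top)))

  c-injective : ∀ i j → c i ≤ c j → i ≡ j
  c-injective true  true  _ = refl
  c-injective false false _ = refl
  c-injective true  false c₁≤c₂ =
    ⊥-elim (c₁≢c₂ (sym (c-cover true c₁≤c₂ (c≢⊤ false))))
  c-injective false true  c₂≤c₁ =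
    ⊥-elim (c₁≢c₂ (c-cover false c₂≤c₁ (c≢⊤ true)))

  above-one-coatom : ∀ i j {z} → c i ≤ z → c j ≤ z → z ≢ ⊤ → i ≡ j
  above-one-coatom i j ci≤z cj≤z z≢⊤ =
    sym (c-injective j i (≤-trans cj≤z (reflexive (c-cover i ci≤z z≢⊤))))

  below-c : ∀ x → x ≢ ⊤ → ∃ λ i → x ≤ c i
  below-c x x≢⊤ with below-coatom ⊤-top x x≢⊤
  ... | z , z-coatom , x≤z with coatom-is-c z z-coatom
  ...   | inj₁ z≡c₁ = true , subst (x ≤_) z≡c₁ x≤z
  ...   | inj₂ z≡c₂ = false , subst (x ≤_) z≡c₂ x≤z

  below-both : ∀ {m n x} → m ≢ n → x ≤ c m → x ≤ c n → ∀ k → x ≤ c k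
  below-both {true}  {true}  m≢n _ _ = ⊥-elim (m≢n refl)
  below-both {false} {false} m≢n _ _ = ⊥-elim (m≢n refl)
  below-both {true}  {false} _ x≤c₁ x≤c₂ = λ { true → x≤c₁ ; false → x≤c₂ }
  below-both {false} {true}  _ x≤c₂ x≤c₁ = λ { true → x≤c₁ ; false → x≤c₂ }

  c₁∧c₂ : Carrier
  c₁∧c₂ = c₁ ∧ c₂

  c₁∧c₂≤c : ∀ i → c₁∧c₂ ≤ c i
  c₁∧c₂≤c true  = x∧y≤x c₁ c₂
  c₁∧c₂≤c false = x∧y≤y c₁ c₂

  ≤-c₁∧c₂ : ∀ {x} → (∀ k → x ≤ c k) → x ≤ c₁∧c₂
  ≤-c₁∧c₂ x≤c = ∧-greatest (x≤c true) (x≤c false)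

  ≤-≢⊤ : ∀ {x y} → x ≤ y → y ≢ ⊤ → x ≢ ⊤
  ≤-≢⊤ x≤y y≢⊤ x≡⊤ = y≢⊤ (antisym (⊤-top _) (subst (_≤ _) x≡⊤ x≤y))

  above-join-⊤ : ∀ {x y z} → x ∨ y ≡ ⊤ → x ≤ z → y ≤ z → z ≡ ⊤
  above-join-⊤ x∨y≡⊤ x≤z y≤z = antisym (⊤-top _) (subst (_≤ _) x∨y≡⊤ (∨-least x≤z y≤z))

module TwoSum (P Q : TwoCoatomLattice) where
  private
    module P = TwoCoatoms P
    module Q = TwoCoatoms Q

  P' : Set
  P' = ∃ λ x → x ≢ P.⊤

  Q' : Set
  Q' = ∃ λ u → u ≢ Q.⊤

  Elem : Set
  Elem = P' ⊎ Q'

  _⊑_ : Elem → Elem → Set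
  inj₁ (x , _) ⊑ inj₁ (y , _) = x P.≤ y
  inj₂ (u , _) ⊑ inj₂ (v , _) = v Q.≤ u
  inj₁ (x , _) ⊑ inj₂ (u , _) = ∃ λ i → (x P.≤ P.c i) × (u Q.≤ Q.c i)
  inj₂ (u , _) ⊑ inj₁ (x , _) = ∃ λ i → (P.c i P.≤ x) × (Q.c i Q.≤ u)

  ⊑-refl : ∀ {X} → X ⊑ X
  ⊑-refl {inj₁ _} = P.≤-refl
  ⊑-refl {inj₂ _} = Q.≤-refl

  -- Passing from Q' down to P' and back up (or conversely) forces both
  -- crossings to use the same coatom, since distinct coatoms are incomparable.
  ⊑-trans : ∀ {X Y Z} → X ⊑ Y → Y ⊑ Z → X ⊑ Z
  ⊑-trans {inj₁ _} {inj₁ _} {inj₁ _} x≤y y≤z = P.≤-trans x≤y y≤z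
  ⊑-trans {inj₁ _} {inj₁ _} {inj₂ _} x≤y (i , y≤c , w≤c) = i , P.≤-trans x≤y y≤c , w≤c
  ⊑-trans {inj₁ _} {inj₂ _} {inj₁ _} (i , x≤ci , v≤ci) (j , cj≤z , cj≤v)
    with Q.c-injective j i (Q.≤-trans cj≤v v≤ci)
  ... | refl = P.≤-trans x≤ci cj≤z
  ⊑-trans {inj₁ _} {inj₂ _} {inj₂ _} (i , x≤c , v≤c) w≤v = i , x≤c , Q.≤-trans w≤v v≤c
  ⊑-trans {inj₂ _} {inj₁ _} {inj₁ _} (i , c≤y , c≤u) y≤z = i , P.≤-trans c≤y y≤z , c≤u
  ⊑-trans {inj₂ _} {inj₁ _} {inj₂ _} (i , ci≤y , ci≤u) (j , y≤cj , w≤cj)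
    with P.c-injective i j (P.≤-trans ci≤y y≤cj)
  ... | refl = Q.≤-trans w≤cj ci≤u
  ⊑-trans {inj₂ _} {inj₂ _} {inj₁ _} v≤u (i , c≤z , c≤v) = i , c≤z , Q.≤-trans c≤v v≤u
  ⊑-trans {inj₂ _} {inj₂ _} {inj₂ _} v≤u w≤v = Q.≤-trans w≤v v≤u

  _⊑?_ : (x : P') (u : Q') → Dec (inj₁ x ⊑ inj₂ u)
  (x , _) ⊑? (u , _) = map′ [ (true ,_) , (false ,_) ] split (via true ⊎-dec via false)
    where
    via : ∀ i → Dec ((x P.≤ P.c i) × (u Q.≤ Q.c i))
    via i = (x P.≤? P.c i) ×-dec (u Q.≤? Q.c i)
    split : ∃ (λ i → (x P.≤ P.c i) × (u Q.≤ Q.c i))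
          → ((x P.≤ P.c true) × (u Q.≤ Q.c true)) ⊎ ((x P.≤ P.c false) × (u Q.≤ Q.c false))
    split (true , below) = inj₁ below
    split (false , below) = inj₂ below

  Join : Elem → Elem → Set
  Join X Y = ∃ (IsJoin _⊑_ X Y)

  -- Two elements of P' are joined in P' unless their join in P is ⊤; then
  -- their join is the meet of the coatoms of Q (for U: the join of its atoms).
  join-P'-P' : (x y : P') → Join (inj₁ x) (inj₁ y)
  join-P'-P' (x , x≢⊤) (y , y≢⊤) with (x P.∨ y) P.≟ P.⊤
  ... | no x∨y≢⊤ = inj₁ (x P.∨ y , x∨y≢⊤) , P.x≤x∨y x y , P.y≤x∨y x y , least
    where
    least : ∀ Z → inj₁ (x , x≢⊤) ⊑ Z → inj₁ (y , y≢⊤) ⊑ Z → inj₁ (x P.∨ y , x∨y≢⊤) ⊑ Z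
    least (inj₁ _) x≤z y≤z = P.∨-least x≤z y≤z
    least (inj₂ _) (m , x≤cm , u≤cm) (n , y≤cn , u≤cn) with m ≟ᵇ n
    ... | yes refl = m , P.∨-least x≤cm y≤cn , u≤cm
    ... | no m≢n =
      let k , x∨y≤ck = P.below-c (x P.∨ y) x∨y≢⊤ in
      k , x∨y≤ck , Q.below-both m≢n u≤cm u≤cn k
  ... | yes x∨y≡⊤ = inj₂ (Q.c₁∧c₂ , c₁∧c₂≢⊤) , via x x≢⊤ , via y y≢⊤ , least
    where
    c₁∧c₂≢⊤ : Q.c₁∧c₂ ≢ Q.⊤
    c₁∧c₂≢⊤ = Q.≤-≢⊤ (Q.c₁∧c₂≤c true) (Q.c≢⊤ true)
    via : ∀ z → (z≢⊤ : z ≢ P.⊤) → inj₁ (z , z≢⊤) ⊑ inj₂ (Q.c₁∧c₂ , c₁∧c₂≢⊤)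
    via z z≢⊤ = let i , z≤ci = P.below-c z z≢⊤ in i , z≤ci , Q.c₁∧c₂≤c i
    least : ∀ Z → inj₁ (x , x≢⊤) ⊑ Z → inj₁ (y , y≢⊤) ⊑ Z → inj₂ (Q.c₁∧c₂ , c₁∧c₂≢⊤) ⊑ Z
    least (inj₁ (z , z≢⊤)) x≤z y≤z = ⊥-elim (z≢⊤ (P.above-join-⊤ x∨y≡⊤ x≤z y≤z))
    least (inj₂ _) (m , x≤cm , u≤cm) (n , y≤cn , u≤cn) with m ≟ᵇ n
    ... | yes refl = ⊥-elim (P.c≢⊤ m (P.above-join-⊤ x∨y≡⊤ x≤cm y≤cn))
    ... | no m≢n = Q.≤-c₁∧c₂ (Q.below-both m≢n u≤cm u≤cn)

  -- Elements of Q' are joined by their meet in Q; an element of P' lies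
  -- below it only through a coatom lying below both.
  join-Q'-Q' : (u v : Q') → Join (inj₂ u) (inj₂ v)
  join-Q'-Q' (u , u≢⊤) (v , v≢⊤) =
    inj₂ (u Q.∧ v , u∧v≢⊤) , Q.x∧y≤x u v , Q.x∧y≤y u v , least
    where
    u∧v≢⊤ : (u Q.∧ v) ≢ Q.⊤
    u∧v≢⊤ = Q.≤-≢⊤ (Q.x∧y≤x u v) u≢⊤
    least : ∀ Z → inj₂ (u , u≢⊤) ⊑ Z → inj₂ (v , v≢⊤) ⊑ Z → inj₂ (u Q.∧ v , u∧v≢⊤) ⊑ Z
    least (inj₂ _) w≤u w≤v = Q.∧-greatest w≤u w≤v
    least (inj₁ (z , z≢⊤)) (i , ci≤z , ci≤u) (j , cj≤z , cj≤v)
      with P.above-one-coatom i j ci≤z cj≤z z≢⊤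
    ... | refl = i , ci≤z , Q.∧-greatest ci≤u cj≤v

  -- If x ∈ P' lies below u ∈ Q' the join is u.  Otherwise pick a coatom c i
  -- of P above x; the join is c i ∧ u computed in Q, and no element of P'
  -- lies above both x and u.
  join-P'-Q' : (x : P') (u : Q') → Join (inj₁ x) (inj₂ u)
  join-P'-Q' (x , x≢⊤) (u , u≢⊤) with (x , x≢⊤) ⊑? (u , u≢⊤) | P.below-c x x≢⊤
  ... | yes x⊑u | _ = inj₂ (u , u≢⊤) , x⊑u , Q.≤-refl , λ _ _ u⊑Z → u⊑Z
  ... | no x⋢u | i , x≤ci =
    inj₂ (Q.c i Q.∧ u , ci∧u≢⊤) , (i , x≤ci , Q.x∧y≤x _ _) , Q.x∧y≤y _ _ , least
    where
    ci∧u≢⊤ : (Q.c i Q.∧ u) ≢ Q.⊤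
    ci∧u≢⊤ = Q.≤-≢⊤ (Q.x∧y≤y _ _) u≢⊤
    least : ∀ Z → inj₁ (x , x≢⊤) ⊑ Z → inj₂ (u , u≢⊤) ⊑ Z → inj₂ (Q.c i Q.∧ u , ci∧u≢⊤) ⊑ Z
    least (inj₂ _) (m , x≤cm , w≤cm) w≤u with m ≟ᵇ i
    ... | yes refl = Q.∧-greatest w≤cm w≤u
    ... | no m≢i =
      let k , u≤ck = Q.below-c u u≢⊤ in
      ⊥-elim (x⋢u (k , P.below-both m≢i x≤cm x≤ci k , u≤ck))
    least (inj₁ (z , z≢⊤)) x≤z (n , cn≤z , cn≤u) =
      ⊥-elim (x⋢u (n , P.≤-trans x≤z (P.reflexive (P.c-cover n cn≤z z≢⊤)) ,
                       Q.reflexive (Q.c-cover n cn≤u u≢⊤)))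

  join-comm : ∀ X Y → Join X Y → Join Y X
  join-comm _ _ (J , X⊑J , Y⊑J , least) = J , Y⊑J , X⊑J , λ Z Y⊑Z X⊑Z → least Z X⊑Z Y⊑Z

  joins : HasJoins _⊑_
  joins (inj₁ x) (inj₁ y) = join-P'-P' x y
  joins (inj₁ x) (inj₂ u) = join-P'-Q' x u
  joins (inj₂ u) (inj₁ x) = join-comm (inj₁ x) (inj₂ u) (join-P'-Q' x u)
  joins (inj₂ u) (inj₂ v) = join-Q'-Q' u v

⊑-reverse : (P Q : TwoCoatomLattice) → ∀ X Y
  → TwoSum._⊑_ P Q X Y → TwoSum._⊑_ Q P (swap Y) (swap X)
⊑-reverse P Q (inj₁ _) (inj₁ _) x≤y = x≤y
⊑-reverse P Q (inj₂ _) (inj₂ _) v≤u = v≤u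
⊑-reverse P Q (inj₁ _) (inj₂ _) (i , x≤ci , u≤ci) = i , u≤ci , x≤ci
⊑-reverse P Q (inj₂ _) (inj₁ _) (i , ci≤x , ci≤u) = i , ci≤u , ci≤x

-- The 2-sum is a lattice: meets are joins of the opposite 2-sum.
two-sum-lattice : (P Q : TwoCoatomLattice) → IsLatticeOrder (TwoSum._⊑_ P Q)
two-sum-lattice P Q =
  TwoSum.joins P Q ,
  meets-from-opposite-joins swap swap swap-involutive
    (⊑-reverse P Q) (⊑-reverse Q P) (TwoSum.joins Q P)

module VerticalSumOrder (L U : FiniteLattice)
  (⊤L : FiniteLattice.Carrier L) (⊤L-top : IsTop L ⊤L)
  (⊥U : FiniteLattice.Carrier U) (⊥U-bot : IsBot U ⊥U)
  (c₁ c₂ : FiniteLattice.Carrier L) (coatoms : ExactlyTwo L (IsCoatom L) c₁ c₂)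
  (a₁ a₂ : FiniteLattice.Carrier U) (atoms : ExactlyTwo U (IsAtom U) a₁ a₂) where

  lower : TwoCoatomLattice
  lower = record
    { lattice = L ; ⊤ = ⊤L ; ⊤-top = ⊤L-top ; c₁ = c₁ ; c₂ = c₂ ; coatoms = coatoms }

  upper : TwoCoatomLattice
  upper = record
    { lattice = opposite U ; ⊤ = ⊥U ; ⊤-top = ⊥U-bot ; c₁ = a₁ ; c₂ = a₂
    ; coatoms = atoms-are-opposite-coatoms U atoms }

  open VerticalTwoSum L U ⊤L ⊥U c₁ c₂ a₁ a₂
  open TwoSum lower upper using (_⊑_; ⊑-refl; ⊑-trans)
  private
    module P = TwoCoatoms lower
    module Q = TwoCoatoms upper

  glued : ∀ i → Identified (P.c i) (Q.c i)
  glued true  = inj₁ (refl , refl)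
  glued false = inj₂ (refl , refl)

  step⇒⊑ : ∀ {X Y} → Step X Y → X ⊑ Y
  step⇒⊑ (inL x≤y) = x≤y
  step⇒⊑ (inU u≤v) = u≤v
  step⇒⊑ (glueLU (inj₁ (refl , refl))) = true , P.≤-refl , Q.≤-refl
  step⇒⊑ (glueLU (inj₂ (refl , refl))) = false , P.≤-refl , Q.≤-refl
  step⇒⊑ (glueUL (inj₁ (refl , refl))) = true , P.≤-refl , Q.≤-refl
  step⇒⊑ (glueUL (inj₂ (refl , refl))) = false , P.≤-refl , Q.≤-refl

  ≤⇒⊑ : ∀ {X Y} → X ≤ Y → X ⊑ Y
  ≤⇒⊑ = fold _⊑_ (λ {X Y Z} X→Y Y⊑Z → ⊑-trans {X} {Y} {Z} (step⇒⊑ X→Y) Y⊑Z)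
                 (λ {X} → ⊑-refl {X})

  -- A crossing between L' and U' is realised by a path through a glued pair.
  ⊑⇒≤ : ∀ {X Y} → X ⊑ Y → X ≤ Y
  ⊑⇒≤ {inj₁ _} {inj₁ _} x≤y = inL x≤y ◅ ε
  ⊑⇒≤ {inj₂ _} {inj₂ _} v≤u = inU v≤u ◅ ε
  ⊑⇒≤ {inj₁ _} {inj₂ _} (i , x≤ci , u≤ai) =
    inL {x' = P.c i , P.c≢⊤ i} x≤ci ◅ glueLU {y = Q.c i , Q.c≢⊤ i} (glued i) ◅ inU u≤ai ◅ ε
  ⊑⇒≤ {inj₂ _} {inj₁ _} (i , ci≤x , ai≤u) =
    inU {y' = Q.c i , Q.c≢⊤ i} ai≤u ◅ glueUL {x = P.c i , P.c≢⊤ i} (glued i) ◅ inL ci≤x ◅ ε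

lemma9 : (L U : FiniteLattice)
    → (⊤L : FiniteLattice.Carrier L) → IsTop L ⊤L
    → (⊥U : FiniteLattice.Carrier U) → IsBot U ⊥U
    → (c₁ c₂ : FiniteLattice.Carrier L) → ExactlyTwo L (IsCoatom L) c₁ c₂
    → (a₁ a₂ : FiniteLattice.Carrier U) → ExactlyTwo U (IsAtom U) a₁ a₂
    → IsLatticeOrder (VerticalTwoSum._≤_ L U ⊤L ⊥U c₁ c₂ a₁ a₂)
lemma9 L U ⊤L ⊤L-top ⊥U ⊥U-bot c₁ c₂ coatoms a₁ a₂ atoms =
  lattice-order-resp-⇔ ⊑⇒≤ ≤⇒⊑ (two-sum-lattice lower upper)
  where open VerticalSumOrder L U ⊤L ⊤L-top ⊥U ⊥U-bot c₁ c₂ coatoms a₁ a₂ atoms
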